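{- Let $p$, $q$ and $z$ be complex numbers, let $m\ge 0$ be an integer, and let $\omega$ be a primitive cube root of unity. For integers $k,n$ define $$g(k,n)=\begin{cases} 3n-k, & \text{if } k\equiv 2 \pmod 3,\\ k, & \text{if } k\equiv 0,1 \pmod 3.\end{cases}$$ Then $$\sum_{n=0}^{3m} q^{\binom{n+1}{2}}\, p^{\binom{n}{2}}\, z^n \begin{bmatrix}3m\\ n\end{bmatrix}_p \sum_{k=n}^{2n} q^{\frac13\left(k^2-g(k,n)\right)-kn}\begin{bmatrix}n\\ k-n\end{bmatrix}_q \omega^k = (z;p)_{3m}.$$
   Context: For a base $b$ and non-negative integer $k$, $(a;b)_k=\prod_{j=0}^{k-1}(1-ab^j)$, with the convention $1/(b;b)_k=0$ for $k<0$. The $b$-binomial coefficient is $\begin{bmatrix}N\\ j\end{bmatrix}_b=\frac{(b;b)_N}{(b;b)_j(b;b)_{N-j}}$ (a polynomial in $b$), which is $0$ if $j<0$ or $j>N$. The exponent $\frac13(k^2-g(k,n))$ is an integer. -}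

module Defs where

open import Level using (Level)
open import Algebra.Bundles using (CommutativeRing)
open import Data.Nat as ℕ using (ℕ; zero; suc; _∸_)
open import Data.Nat.Combinatorics using (_C_)
open import Data.Integer as ℤ using (ℤ; +_; -[1+_])
open import Data.Integer.DivMod using (_/_)

gfun : ℕ → ℕ → ℤ
gfun k n with k ℕ.% 3
... | 2 = ℤ._-_ (+ (3 ℕ.* n)) (+ k)
... | _ = + k

-- the exponent (1/3)(k^2 - g(k,n)) - k n  (the division is exact)
qExp : ℕ → ℕ → ℤ
qExp k n = ℤ._-_ ((ℤ._-_ (+ (k ℕ.* k)) (gfun k n)) / (+ 3)) (+ (k ℕ.* n))

module _ {c ℓ : Level} (R : CommutativeRing c ℓ) where
  open CommutativeRing R

  pow : Carrier → ℕ → Carrier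
  pow x zero = 1#
  pow x (suc n) = x * pow x n

  -- integer power of x, given a chosen inverse xi of x
  zpow : Carrier → Carrier → ℤ → Carrier
  zpow x xi (+ n) = pow x n
  zpow x xi -[1+ n ] = pow xi (suc n)

  poch : Carrier → Carrier → ℕ → Carrier
  poch a b zero = 1#
  poch a b (suc k) = poch a b k * (1# - a * pow b k)

  -- b-binomial coefficient [N choose j]_b, as the Gaussian polynomial
  -- evaluated at b (q-Pascal recurrence); 0 for j > N.
  qbin : Carrier → ℕ → ℕ → Carrier
  qbin b zero zero = 1#
  qbin b zero (suc j) = 0#
  qbin b (suc N) zero = 1#
  qbin b (suc N) (suc j) = qbin b N j + pow b (suc j) * qbin b N (suc j)

  sumFrom : ℕ → ℕ → (ℕ → Carrier) → Carrier
  sumFrom a zero f = 0#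
  sumFrom a (suc len) f = f a + sumFrom (suc a) len f

  sumRange : ℕ → ℕ → (ℕ → Carrier) → Carrier
  sumRange a b f = sumFrom a (suc b ∸ a) f

  theorem3LHS : (p q qi z ω : Carrier) → ℕ → Carrier
  theorem3LHS p q qi z ω m =
    sumRange 0 (3 ℕ.* m) λ n →
      pow q ((suc n) C 2) * pow p (n C 2) * pow z n * qbin p (3 ℕ.* m) n *
      sumRange n (2 ℕ.* n) (λ k →
        zpow q qi (qExp k n) * qbin q n (k ∸ n) * pow ω k)

{-# OPTIONS --safe #-}
module Submission where

-- Put k = n + j, so that the inner sum is Σⱼ w(n, n + j) ω^(n + j) [n; j]_q with w(n, k) = q^(qExp k n).
-- Since ω³ = 1 and ω² = -1 - ω, it equals D n + ω X n, where D n weights the terms with k ≡ 0 (mod 3)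
-- by +w and those with k ≡ 2 by -w, and X n weights the terms with k ≡ 1 by +w and those with k ≡ 2 by -w.
-- The reflection j ↦ n - j sends k to 3n - k, which swaps the classes 1 and 2 and satisfies
-- w(n, k) = w(n, 3n - k) for k ≡ 1; by the symmetry of [n; j]_q this gives X n = 0.
-- Expanding [n + 1; j]_q by one Pascal rule on the class k ≡ 0 and by the other on k ≡ 2 gives
-- D (n + 1) = -q^-(n + 1) D n, so q^C(n+1,2) D n = (-1)^n.
-- The outer sum is then Rothe's q-binomial theorem Σₙ (-1)^n p^C(n,2) z^n [N; n]_p = (z; p)_N,
-- which holds for every N, not only N = 3m.

open import Defs
open import Level using (Level)
open import Algebra.Bundles using (CommutativeRing)
open import Data.Nat using (ℕ; zero; suc; _∸_; z≤n; s≤s)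
import Data.Nat as ℕ
import Data.Nat.Properties as ℕₚ
open import Data.Nat.DivMod using ([m+kn]%n≡m%n; m*n/n≡m; m*n%n≡0)
open import Data.Nat.Combinatorics using (_C_; nCk+nC[k+1]≡[n+1]C[k+1]; nC1≡n)
open import Data.Integer.Base using (ℤ; +_; -[1+_])
import Data.Integer.Base as ℤ using (_+_; _-_; _*_; -_; _⊖_; _/_; _/ℕ_)
import Data.Integer.Properties as ℤₚ
open import Data.Integer.DivMod using (div-pos-is-/ℕ)
open import Data.Integer.Divisibility.Signed using (_∣_; divides)
open import Data.Integer.Tactic.RingSolver using (solve-∀)
open import Data.Fin.Base using (toℕ; inject₁; fromℕ; opposite)
open import Data.Fin.Properties using (toℕ<n; toℕ-inject₁; toℕ-fromℕ; opposite-prop)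
open import Data.Fin.Permutation using (reverse)
open import Data.Product using (_,_)
open import Data.Sum using (inj₁; inj₂)
open import Relation.Nullary using (yes; no)
open import Relation.Binary.PropositionalEquality as ≡ using (_≡_)

module Residues where
  open ≡

  data Mod3 : Set where
    0₃ 1₃ 2₃ : Mod3

  toℕ₃ : Mod3 → ℕ
  toℕ₃ 0₃ = 0
  toℕ₃ 1₃ = 1
  toℕ₃ 2₃ = 2

  suc₃ : Mod3 → Mod3
  suc₃ 0₃ = 1₃
  suc₃ 1₃ = 2₃
  suc₃ 2₃ = 0₃

  _+₃_ : Mod3 → Mod3 → Mod3
  0₃ +₃ s = s
  1₃ +₃ s = suc₃ s
  2₃ +₃ s = suc₃ (suc₃ s)

  -₃_ : Mod3 → Mod3
  -₃ 0₃ = 0₃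
  -₃ 1₃ = 2₃
  -₃ 2₃ = 1₃

  residue : ℕ → Mod3
  residue zero = 0₃
  residue (suc k) = suc₃ (residue k)

  suc₃-+₃ : ∀ r s → suc₃ r +₃ s ≡ suc₃ (r +₃ s)
  suc₃-+₃ 0₃ s = refl
  suc₃-+₃ 1₃ s = refl
  suc₃-+₃ 2₃ 0₃ = refl
  suc₃-+₃ 2₃ 1₃ = refl
  suc₃-+₃ 2₃ 2₃ = refl

  residue-+ : ∀ m n → residue (m ℕ.+ n) ≡ residue m +₃ residue n
  residue-+ zero n = refl
  residue-+ (suc m) n = trans (cong suc₃ (residue-+ m n)) (sym (suc₃-+₃ (residue m) (residue n)))

  residue-reflect : ∀ j t → residue (j ℕ.+ t ℕ.+ j) ≡ -₃ residue (j ℕ.+ t ℕ.+ t)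
  residue-reflect j t
    rewrite residue-+ (j ℕ.+ t) j | residue-+ (j ℕ.+ t) t | residue-+ j t = 3·r≡0 (residue j) (residue t)
    where
    3·r≡0 : ∀ a b → (a +₃ b) +₃ a ≡ -₃ ((a +₃ b) +₃ b)
    3·r≡0 0₃ 0₃ = refl
    3·r≡0 0₃ 1₃ = refl
    3·r≡0 0₃ 2₃ = refl
    3·r≡0 1₃ 0₃ = refl
    3·r≡0 1₃ 1₃ = refl
    3·r≡0 1₃ 2₃ = refl
    3·r≡0 2₃ 0₃ = refl
    3·r≡0 2₃ 1₃ = refl
    3·r≡0 2₃ 2₃ = refl

  data DivMod3 : ℕ → Set where
    _·3+_ : ∀ b r → DivMod3 (toℕ₃ r ℕ.+ b ℕ.* 3)

  divMod3 : ∀ k → DivMod3 k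
  divMod3 zero = 0 ·3+ 0₃
  divMod3 (suc k) with divMod3 k
  ... | b ·3+ 0₃ = b ·3+ 1₃
  ... | b ·3+ 1₃ = b ·3+ 2₃
  ... | b ·3+ 2₃ = suc b ·3+ 0₃

  residue-*3 : ∀ b → residue (b ℕ.* 3) ≡ 0₃
  residue-*3 zero = refl
  residue-*3 (suc b) rewrite residue-*3 b = refl

  residue-·3+ : ∀ b r → residue (toℕ₃ r ℕ.+ b ℕ.* 3) ≡ r
  residue-·3+ b 0₃ rewrite residue-*3 b = refl
  residue-·3+ b 1₃ rewrite residue-*3 b = refl
  residue-·3+ b 2₃ rewrite residue-*3 b = refl

open Residues

module Exponents where
  open ≡

  w*3/3≡w : ∀ w → (w ℤ.* + 3) ℤ./ + 3 ≡ w
  w*3/3≡w (+ n) = begin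
    (+ n ℤ.* + 3) ℤ./ + 3   ≡⟨ div-pos-is-/ℕ (+ n ℤ.* + 3) 3 ⟩
    (+ n ℤ.* + 3) ℤ./ℕ 3    ≡⟨ cong (ℤ._/ℕ 3) (ℤₚ.pos-* n 3) ⟨
    + (n ℕ.* 3 ℕ./ 3)       ≡⟨ cong +_ (m*n/n≡m n 3) ⟩
    + n                     ∎
    where open ≡-Reasoning
  w*3/3≡w -[1+ n ] = trans (div-pos-is-/ℕ (-[1+ n ] ℤ.* + 3) 3) neg
    where
    neg : -[1+ suc (suc (n ℕ.* 3)) ] ℤ./ℕ 3 ≡ -[1+ n ]
    neg with suc (suc (suc (n ℕ.* 3))) ℕ.% 3 in r
    ... | zero  = cong (λ x → ℤ.- (+ x)) (m*n/n≡m (suc n) 3)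
    ... | suc _ with () ← trans (sym r) (m*n%n≡0 (suc n) 3)

  a/3*3≡a : ∀ {a} → + 3 ∣ a → (a ℤ./ + 3) ℤ.* + 3 ≡ a
  a/3*3≡a (divides w refl) = cong (ℤ._* + 3) (w*3/3≡w w)

  g₃ : Mod3 → ℤ → ℤ → ℤ
  g₃ 0₃ k n = k
  g₃ 1₃ k n = k
  g₃ 2₃ k n = + 3 ℤ.* n ℤ.- k

  gfun-·3+ : ∀ b r n → let k = toℕ₃ r ℕ.+ b ℕ.* 3 in gfun k n ≡ g₃ r (+ k) (+ n)
  gfun-·3+ b 0₃ n rewrite [m+kn]%n≡m%n 0 b 3 ⦃ _ ⦄ = refl
  gfun-·3+ b 1₃ n rewrite [m+kn]%n≡m%n 1 b 3 ⦃ _ ⦄ = refl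
  gfun-·3+ b 2₃ n rewrite [m+kn]%n≡m%n 2 b 3 ⦃ _ ⦄ = cong (λ x → x ℤ.- + (2 ℕ.+ b ℕ.* 3)) (ℤₚ.pos-* 3 n)

  gfun≡g₃ : ∀ k n → gfun k n ≡ g₃ (residue k) (+ k) (+ n)
  gfun≡g₃ k n with divMod3 k
  ... | b ·3+ r rewrite residue-·3+ b r = gfun-·3+ b r n

  3∣k²-g : ∀ k n → + 3 ∣ (+ k ℤ.* + k ℤ.- g₃ (residue k) (+ k) (+ n))
  3∣k²-g k n with divMod3 k
  ... | b ·3+ r rewrite residue-·3+ b r =
    subst (λ K → + 3 ∣ (K ℤ.* K ℤ.- g₃ r K (+ n))) (cong (λ x → + toℕ₃ r ℤ.+ x) (sym (ℤₚ.pos-* b 3))) (by-residue r)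
    where
    B = + b
    N = + n
    by-residue : ∀ r → let K = + toℕ₃ r ℤ.+ B ℤ.* + 3 in + 3 ∣ (K ℤ.* K ℤ.- g₃ r K N)
    by-residue 0₃ = divides (+ 3 ℤ.* B ℤ.* B ℤ.- B) (e B)
      where
      e : ∀ B → (+ 0 ℤ.+ B ℤ.* + 3) ℤ.* (+ 0 ℤ.+ B ℤ.* + 3) ℤ.- (+ 0 ℤ.+ B ℤ.* + 3) ≡ (+ 3 ℤ.* B ℤ.* B ℤ.- B) ℤ.* + 3
      e = solve-∀
    by-residue 1₃ = divides (+ 3 ℤ.* B ℤ.* B ℤ.+ B) (e B)
      where
      e : ∀ B → (+ 1 ℤ.+ B ℤ.* + 3) ℤ.* (+ 1 ℤ.+ B ℤ.* + 3) ℤ.- (+ 1 ℤ.+ B ℤ.* + 3) ≡ (+ 3 ℤ.* B ℤ.* B ℤ.+ B) ℤ.* + 3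
      e = solve-∀
    by-residue 2₃ = divides (+ 3 ℤ.* B ℤ.* B ℤ.+ + 5 ℤ.* B ℤ.+ + 2 ℤ.- N) (e B N)
      where
      e : ∀ B N → (+ 2 ℤ.+ B ℤ.* + 3) ℤ.* (+ 2 ℤ.+ B ℤ.* + 3) ℤ.- (+ 3 ℤ.* N ℤ.- (+ 2 ℤ.+ B ℤ.* + 3))
                  ≡ (+ 3 ℤ.* B ℤ.* B ℤ.+ + 5 ℤ.* B ℤ.+ + 2 ℤ.- N) ℤ.* + 3
      e = solve-∀

  qExpPoly : Mod3 → ℤ → ℤ → ℤ
  qExpPoly r k n = k ℤ.* k ℤ.- g₃ r k n ℤ.- + 3 ℤ.* k ℤ.* n

  qExp×3 : ∀ k n → qExp k n ℤ.* + 3 ≡ qExpPoly (residue k) (+ k) (+ n)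
  qExp×3 k n = begin
    (a ℤ./ + 3 ℤ.- + (k ℕ.* n)) ℤ.* + 3          ≡⟨ distrib (a ℤ./ + 3) (+ (k ℕ.* n)) ⟩
    (a ℤ./ + 3) ℤ.* + 3 ℤ.- + 3 ℤ.* + (k ℕ.* n) ≡⟨ cong₂ ℤ._-_ exact kn ⟩
    + k ℤ.* + k ℤ.- g₃ (residue k) (+ k) (+ n) ℤ.- + 3 ℤ.* + k ℤ.* + n ∎
    where
    open ≡-Reasoning
    a = + (k ℕ.* k) ℤ.- gfun k n
    exact : (a ℤ./ + 3) ℤ.* + 3 ≡ + k ℤ.* + k ℤ.- g₃ (residue k) (+ k) (+ n)
    exact rewrite ℤₚ.pos-* k k | gfun≡g₃ k n = a/3*3≡a (3∣k²-g k n)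
    kn : + 3 ℤ.* + (k ℕ.* n) ≡ + 3 ℤ.* + k ℤ.* + n
    kn = trans (cong (λ x → + 3 ℤ.* x) (ℤₚ.pos-* k n)) (sym (ℤₚ.*-assoc (+ 3) (+ k) (+ n)))
    distrib : ∀ x y → (x ℤ.- y) ℤ.* + 3 ≡ x ℤ.* + 3 ℤ.- + 3 ℤ.* y
    distrib = solve-∀

  qExp≡ : ∀ {r r′} k n k′ n′ → residue k ≡ r → residue k′ ≡ r′ →
          qExpPoly r (+ k) (+ n) ≡ qExpPoly r′ (+ k′) (+ n′) → qExp k n ≡ qExp k′ n′
  qExp≡ {r} {r′} k n k′ n′ ≡r ≡r′ eq = ℤₚ.*-cancelʳ-≡ _ _ (+ 3) (begin
    qExp k n ℤ.* + 3                   ≡⟨ qExp×3 k n ⟩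
    qExpPoly (residue k) (+ k) (+ n)    ≡⟨ cong (λ s → qExpPoly s (+ k) (+ n)) ≡r ⟩
    qExpPoly r (+ k) (+ n)              ≡⟨ eq ⟩
    qExpPoly r′ (+ k′) (+ n′)            ≡⟨ cong (λ s → qExpPoly s (+ k′) (+ n′)) ≡r′ ⟨
    qExpPoly (residue k′) (+ k′) (+ n′) ≡⟨ qExp×3 k′ n′ ⟨
    qExp k′ n′ ℤ.* + 3                 ∎)
    where open ≡-Reasoning

  qExp-shift : ∀ {r r′} a k n b k′ n′ → residue k ≡ r → residue k′ ≡ r′ →
               a ℤ.* + 3 ℤ.+ qExpPoly r (+ k) (+ n) ≡ b ℤ.* + 3 ℤ.+ qExpPoly r′ (+ k′) (+ n′) →
               a ℤ.+ qExp k n ≡ b ℤ.+ qExp k′ n′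
  qExp-shift {r} {r′} a k n b k′ n′ ≡r ≡r′ eq = ℤₚ.*-cancelʳ-≡ _ _ (+ 3) (begin
    (a ℤ.+ qExp k n) ℤ.* + 3                          ≡⟨ ℤₚ.*-distribʳ-+ (+ 3) a (qExp k n) ⟩
    a ℤ.* + 3 ℤ.+ qExp k n ℤ.* + 3                    ≡⟨ cong (λ x → a ℤ.* + 3 ℤ.+ x) (qExp×3 k n) ⟩
    a ℤ.* + 3 ℤ.+ qExpPoly (residue k) (+ k) (+ n)     ≡⟨ cong (λ s → a ℤ.* + 3 ℤ.+ qExpPoly s (+ k) (+ n)) ≡r ⟩
    a ℤ.* + 3 ℤ.+ qExpPoly r (+ k) (+ n)               ≡⟨ eq ⟩
    b ℤ.* + 3 ℤ.+ qExpPoly r′ (+ k′) (+ n′)             ≡⟨ cong (λ s → b ℤ.* + 3 ℤ.+ qExpPoly s (+ k′) (+ n′)) ≡r′ ⟨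
    b ℤ.* + 3 ℤ.+ qExpPoly (residue k′) (+ k′) (+ n′)  ≡⟨ cong (λ x → b ℤ.* + 3 ℤ.+ x) (qExp×3 k′ n′) ⟨
    b ℤ.* + 3 ℤ.+ qExp k′ n′ ℤ.* + 3                  ≡⟨ ℤₚ.*-distribʳ-+ (+ 3) b (qExp k′ n′) ⟨
    (b ℤ.+ qExp k′ n′) ℤ.* + 3                        ∎)
    where open ≡-Reasoning

  qExp-carry : ∀ k m → residue k ≡ 1₃ → qExp (2 ℕ.+ k) m ≡ qExp (1 ℕ.+ k) m
  qExp-carry k m r≡1 = qExp≡ (2 ℕ.+ k) m (1 ℕ.+ k) m (cong (λ s → suc₃ (suc₃ s)) r≡1) (cong suc₃ r≡1) (poly (+ k) (+ m))
    where
    poly : ∀ K M → (+ 2 ℤ.+ K) ℤ.* (+ 2 ℤ.+ K) ℤ.- (+ 2 ℤ.+ K) ℤ.- + 3 ℤ.* (+ 2 ℤ.+ K) ℤ.* M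
                 ≡ (+ 1 ℤ.+ K) ℤ.* (+ 1 ℤ.+ K) ℤ.- (+ 3 ℤ.* M ℤ.- (+ 1 ℤ.+ K)) ℤ.- + 3 ℤ.* (+ 1 ℤ.+ K) ℤ.* M
    poly = solve-∀

  qExp-reflect : ∀ j t → let n = j ℕ.+ t in residue (n ℕ.+ t) ≡ 1₃ → qExp (n ℕ.+ t) n ≡ qExp (n ℕ.+ j) n
  qExp-reflect j t r≡1 = qExp≡ (j ℕ.+ t ℕ.+ t) (j ℕ.+ t) (j ℕ.+ t ℕ.+ j) (j ℕ.+ t)
    r≡1 (trans (residue-reflect j t) (cong -₃_ r≡1)) (poly (+ j) (+ t))
    where
    poly : ∀ J T → let N = J ℤ.+ T in
           (N ℤ.+ T) ℤ.* (N ℤ.+ T) ℤ.- (N ℤ.+ T) ℤ.- + 3 ℤ.* (N ℤ.+ T) ℤ.* N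
           ≡ (N ℤ.+ J) ℤ.* (N ℤ.+ J) ℤ.- (+ 3 ℤ.* N ℤ.- (N ℤ.+ J)) ℤ.- + 3 ℤ.* (N ℤ.+ J) ℤ.* N
    poly = solve-∀

  qExp-step₀ : ∀ j t → let n = j ℕ.+ t; k = n ℕ.+ j in
               residue k ≡ 0₃ → + t ℤ.+ qExp (2 ℕ.+ k) (1 ℕ.+ n) ≡ -[1+ n ] ℤ.+ qExp k n
  qExp-step₀ j t r≡0 = qExp-shift (+ t) (2 ℕ.+ (j ℕ.+ t ℕ.+ j)) (1 ℕ.+ (j ℕ.+ t)) -[1+ j ℕ.+ t ] (j ℕ.+ t ℕ.+ j) (j ℕ.+ t)
    (cong (λ s → suc₃ (suc₃ s)) r≡0) r≡0 (poly (+ j) (+ t))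
    where
    poly : ∀ J T → let N = J ℤ.+ T; K = N ℤ.+ J in
           T ℤ.* + 3 ℤ.+ ((+ 2 ℤ.+ K) ℤ.* (+ 2 ℤ.+ K) ℤ.- (+ 3 ℤ.* (+ 1 ℤ.+ N) ℤ.- (+ 2 ℤ.+ K)) ℤ.- + 3 ℤ.* (+ 2 ℤ.+ K) ℤ.* (+ 1 ℤ.+ N))
           ≡ ℤ.- (+ 1 ℤ.+ N) ℤ.* + 3 ℤ.+ (K ℤ.* K ℤ.- K ℤ.- + 3 ℤ.* K ℤ.* N)
    poly = solve-∀

  qExp-step₂ : ∀ j t → let n = j ℕ.+ t; k = n ℕ.+ j in
               residue k ≡ 2₃ → + j ℤ.+ qExp (1 ℕ.+ k) (1 ℕ.+ n) ≡ -[1+ n ] ℤ.+ qExp k n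
  qExp-step₂ j t r≡2 = qExp-shift (+ j) (1 ℕ.+ (j ℕ.+ t ℕ.+ j)) (1 ℕ.+ (j ℕ.+ t)) -[1+ j ℕ.+ t ] (j ℕ.+ t ℕ.+ j) (j ℕ.+ t)
    (cong suc₃ r≡2) r≡2 (poly (+ j) (+ t))
    where
    poly : ∀ J T → let N = J ℤ.+ T; K = N ℤ.+ J in
           J ℤ.* + 3 ℤ.+ ((+ 1 ℤ.+ K) ℤ.* (+ 1 ℤ.+ K) ℤ.- (+ 1 ℤ.+ K) ℤ.- + 3 ℤ.* (+ 1 ℤ.+ K) ℤ.* (+ 1 ℤ.+ N))
           ≡ ℤ.- (+ 1 ℤ.+ N) ℤ.* + 3 ℤ.+ (K ℤ.* K ℤ.- (+ 3 ℤ.* N ℤ.- K) ℤ.- + 3 ℤ.* K ℤ.* N)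
    poly = solve-∀

open Exponents

C2-suc : ∀ n → suc n C 2 ≡ n C 2 ℕ.+ n
C2-suc n = ≡.trans (≡.sym (nCk+nC[k+1]≡[n+1]C[k+1] n 1)) (≡.trans (≡.cong (ℕ._+ n C 2) (nC1≡n n)) (ℕₚ.+-comm n (n C 2)))

module _ {c ℓ : Level} (R : CommutativeRing c ℓ) where
  open CommutativeRing R hiding (zero)
  open import Relation.Binary.Reasoning.Setoid setoid
  open import Algebra.Properties.Ring ring using (-‿distribˡ-*; -‿distribʳ-*; [y-z]x≈yx-zx)
  open import Algebra.Properties.AbelianGroup +-abelianGroup using (⁻¹-∙-comm)
  open import Algebra.Properties.Group +-group using (identityˡ-unique; inverseˡ-unique; ⁻¹-involutive)
  open import Algebra.Properties.CommutativeSemigroup +-commutativeSemigroup using (interchange; x∙yz≈y∙xz)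
  import Algebra.Properties.CommutativeSemigroup *-commutativeSemigroup as *
  import Algebra.Properties.CommutativeSemiring.Exp commutativeSemiring as Exp
  import Algebra.Properties.Semiring.Sum semiring as Sum

  infixr 8 _^_
  _^_ : Carrier → ℕ → Carrier
  x ^ n = pow R x n

  pow≡^ : ∀ x n → x ^ n ≡ x Exp.^ n
  pow≡^ x zero = ≡.refl
  pow≡^ x (suc n) = ≡.cong (x *_) (pow≡^ x n)

  ^-homo-* : ∀ x m n → x ^ (m ℕ.+ n) ≈ x ^ m * x ^ n
  ^-homo-* x m n rewrite pow≡^ x (m ℕ.+ n) | pow≡^ x m | pow≡^ x n = Exp.^-homo-* x m n

  ^-distrib-* : ∀ x y n → (x * y) ^ n ≈ x ^ n * y ^ n
  ^-distrib-* x y n rewrite pow≡^ (x * y) n | pow≡^ x n | pow≡^ y n = Exp.^-distrib-* x y n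

  -x*y≈x*-y : ∀ x y → - x * y ≈ x * - y
  -x*y≈x*-y x y = trans (sym (-‿distribˡ-* x y)) (-‿distribʳ-* x y)

  module _ (x x⁻¹ : Carrier) (x*x⁻¹≈1 : x * x⁻¹ ≈ 1#) where

    ^-inverse : ∀ n → x ^ n * x⁻¹ ^ n ≈ 1#
    ^-inverse zero = *-identityˡ 1#
    ^-inverse (suc n) = begin
      (x * x ^ n) * (x⁻¹ * x⁻¹ ^ n) ≈⟨ *.interchange x (x ^ n) x⁻¹ (x⁻¹ ^ n) ⟩
      (x * x⁻¹) * (x ^ n * x⁻¹ ^ n) ≈⟨ *-cong x*x⁻¹≈1 (^-inverse n) ⟩
      1# * 1#                       ≈⟨ *-identityˡ 1# ⟩
      1#                            ∎

    zpow-⊖ : ∀ m n → zpow R x x⁻¹ (m ℤ.⊖ n) ≈ x ^ m * x⁻¹ ^ n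
    zpow-⊖ m zero rewrite ℤₚ.⊖-≥ {m} {0} z≤n = sym (*-identityʳ _)
    zpow-⊖ zero (suc n) = sym (*-identityˡ _)
    zpow-⊖ (suc m) (suc n) rewrite ℤₚ.[1+m]⊖[1+n]≡m⊖n m n = begin
      zpow R x x⁻¹ (m ℤ.⊖ n)          ≈⟨ zpow-⊖ m n ⟩
      x ^ m * x⁻¹ ^ n                 ≈⟨ *-identityˡ _ ⟨
      1# * (x ^ m * x⁻¹ ^ n)          ≈⟨ *-congʳ x*x⁻¹≈1 ⟨
      (x * x⁻¹) * (x ^ m * x⁻¹ ^ n)   ≈⟨ *.interchange x x⁻¹ (x ^ m) (x⁻¹ ^ n) ⟩
      (x * x ^ m) * (x⁻¹ * x⁻¹ ^ n)   ∎

    zpow-homo : ∀ a b → zpow R x x⁻¹ (a ℤ.+ b) ≈ zpow R x x⁻¹ a * zpow R x x⁻¹ b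
    zpow-homo (+ m) (+ n) = ^-homo-* x m n
    zpow-homo (+ m) -[1+ n ] = zpow-⊖ m (suc n)
    zpow-homo -[1+ m ] (+ n) = trans (zpow-⊖ n (suc m)) (*-comm _ _)
    zpow-homo -[1+ m ] -[1+ n ] = begin
      x⁻¹ ^ suc (suc (m ℕ.+ n))  ≡⟨ ≡.cong (λ e → x⁻¹ ^ suc e) (ℕₚ.+-suc m n) ⟨
      x⁻¹ ^ (suc m ℕ.+ suc n)    ≈⟨ ^-homo-* x⁻¹ (suc m) (suc n) ⟩
      x⁻¹ ^ suc m * x⁻¹ ^ suc n  ∎

  ∑< : ℕ → (ℕ → Carrier) → Carrier
  ∑< n f = Sum.sum {n} (λ i → f (toℕ i))

  ∑<-cong : ∀ n {f g : ℕ → Carrier} → (∀ j → j ℕ.< n → f j ≈ g j) → ∑< n f ≈ ∑< n g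
  ∑<-cong n f≈g = Sum.sum-cong-≋ {n} (λ i → f≈g (toℕ i) (toℕ<n i))

  ∑<-distrib-+ : ∀ n (f g : ℕ → Carrier) → ∑< n (λ j → f j + g j) ≈ ∑< n f + ∑< n g
  ∑<-distrib-+ n f g = Sum.∑-distrib-+ {n} (λ i → f (toℕ i)) (λ i → g (toℕ i))

  *-distribˡ-∑< : ∀ n x (f : ℕ → Carrier) → x * ∑< n f ≈ ∑< n (λ j → x * f j)
  *-distribˡ-∑< n x f = Sum.*-distribˡ-sum {n} x (λ i → f (toℕ i))

  ∑<-init-last : ∀ n (f : ℕ → Carrier) → ∑< (suc n) f ≈ ∑< n f + f n
  ∑<-init-last n f = begin
    ∑< (suc n) f                                       ≈⟨ Sum.sum-init-last {n} (λ i → f (toℕ i)) ⟩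
    Sum.sum {n} (λ i → f (toℕ (inject₁ i))) + f (toℕ (fromℕ n))
      ≡⟨ ≡.cong₂ _+_ (Sum.sum-cong-≗ {n} (λ i → ≡.cong f (toℕ-inject₁ i))) (≡.cong f (toℕ-fromℕ n)) ⟩
    ∑< n f + f n                                       ∎

  ∑<-reverse : ∀ n (f : ℕ → Carrier) → ∑< n f ≈ ∑< n (λ j → f (n ∸ suc j))
  ∑<-reverse n f = begin
    ∑< n f                                                ≈⟨ Sum.sum-permute {n} {n} (λ i → f (toℕ i)) reverse ⟩
    Sum.sum {n} (λ i → f (toℕ (opposite i)))   ≡⟨ Sum.sum-cong-≗ {n} (λ i → ≡.cong f (opposite-prop i)) ⟩
    ∑< n (λ j → f (n ∸ suc j))                           ∎

  sumFrom≈∑< : ∀ a n (f : ℕ → Carrier) → sumFrom R a n f ≈ ∑< n (λ j → f (a ℕ.+ j))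
  sumFrom≈∑< a zero f = refl
  sumFrom≈∑< a (suc n) f = +-cong (reflexive (≡.cong f (≡.sym (ℕₚ.+-identityʳ a))))
    (trans (sumFrom≈∑< (suc a) n f) (∑<-cong n (λ j _ → reflexive (≡.cong f (≡.sym (ℕₚ.+-suc a j))))))

  -- Gaussian binomial coefficients

  qbin-zero : ∀ b N → qbin R b N 0 ≡ 1#
  qbin-zero b zero = ≡.refl
  qbin-zero b (suc N) = ≡.refl

  qbin-above : ∀ b N j → N ℕ.< j → qbin R b N j ≈ 0#
  qbin-above b zero (suc j) _ = refl
  qbin-above b (suc N) (suc j) (s≤s N<j) = begin
    qbin R b N j + b ^ suc j * qbin R b N (suc j) ≈⟨ +-cong (qbin-above b N j N<j) (*-congˡ (qbin-above b N (suc j) (ℕₚ.m<n⇒m<1+n N<j))) ⟩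
    0# + b ^ suc j * 0#                           ≈⟨ +-identityˡ _ ⟩
    b ^ suc j * 0#                                ≈⟨ zeroʳ _ ⟩
    0#                                            ∎

  qbin-diag : ∀ b N → qbin R b N N ≈ 1#
  qbin-diag b zero = refl
  qbin-diag b (suc N) = begin
    qbin R b N N + b ^ suc N * qbin R b N (suc N) ≈⟨ +-cong (qbin-diag b N) (*-congˡ (qbin-above b N (suc N) ℕₚ.≤-refl)) ⟩
    1# + b ^ suc N * 0#                           ≈⟨ +-congˡ (zeroʳ _) ⟩
    1# + 0#                                       ≈⟨ +-identityʳ 1# ⟩
    1#                                            ∎

  -- When suc i > N the two exponents differ (truncated subtraction), but then the binomial vanishes.
  ^-exchange-qbin : ∀ b N i → b ^ suc (suc i) * (b ^ (N ∸ suc i) * qbin R b N (suc i))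
                              ≈ b ^ (N ∸ i) * (b ^ suc i * qbin R b N (suc i))
  ^-exchange-qbin b N i with suc i ℕₚ.≤? N
  ... | yes i<N = begin
    b ^ suc (suc i) * (b ^ (N ∸ suc i) * Y)   ≈⟨ *-assoc _ _ _ ⟨
    b ^ suc (suc i) * b ^ (N ∸ suc i) * Y     ≈⟨ *-congʳ (^-homo-* b (suc (suc i)) (N ∸ suc i)) ⟨
    b ^ (suc (suc i) ℕ.+ (N ∸ suc i)) * Y     ≡⟨ ≡.cong (λ e → b ^ e * Y) exponents ⟩
    b ^ (N ∸ i ℕ.+ suc i) * Y                 ≈⟨ *-congʳ (^-homo-* b (N ∸ i) (suc i)) ⟩
    b ^ (N ∸ i) * b ^ suc i * Y               ≈⟨ *-assoc _ _ _ ⟩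
    b ^ (N ∸ i) * (b ^ suc i * Y)             ∎
    where
    Y = qbin R b N (suc i)
    exponents : suc (suc i) ℕ.+ (N ∸ suc i) ≡ N ∸ i ℕ.+ suc i
    exponents = ≡.trans (≡.cong suc (ℕₚ.m+[n∸m]≡n i<N))
                        (≡.sym (≡.trans (ℕₚ.+-suc (N ∸ i) i) (≡.cong suc (ℕₚ.m∸n+n≡m (ℕₚ.<⇒≤ i<N)))))
  ... | no i≮N = begin
    b ^ suc (suc i) * (b ^ (N ∸ suc i) * Y)   ≈⟨ *-congˡ (*-congˡ Y≈0) ⟩
    b ^ suc (suc i) * (b ^ (N ∸ suc i) * 0#)  ≈⟨ trans (*-congˡ (zeroʳ _)) (zeroʳ _) ⟩
    0#                                        ≈⟨ trans (*-congˡ (zeroʳ _)) (zeroʳ _) ⟨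
    b ^ (N ∸ i) * (b ^ suc i * 0#)            ≈⟨ *-congˡ (*-congˡ Y≈0) ⟨
    b ^ (N ∸ i) * (b ^ suc i * Y)             ∎
    where
    Y = qbin R b N (suc i)
    Y≈0 : Y ≈ 0#
    Y≈0 = qbin-above b N (suc i) (ℕₚ.≰⇒> i≮N)

  qbin-pascalʳ : ∀ b N i → qbin R b (suc N) (suc i) ≈ b ^ (N ∸ i) * qbin R b N i + qbin R b N (suc i)
  qbin-pascalʳ b zero zero = begin
    1# + b ^ 1 * 0#  ≈⟨ +-congˡ (zeroʳ _) ⟩
    1# + 0#          ≈⟨ +-congʳ (*-identityˡ 1#) ⟨
    1# * 1# + 0#     ∎
  qbin-pascalʳ b zero (suc i) = begin
    0# + b ^ suc (suc i) * 0#  ≈⟨ +-congˡ (zeroʳ _) ⟩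
    0# + 0#                    ≈⟨ +-congʳ (zeroʳ 1#) ⟨
    1# * 0# + 0#               ∎
  qbin-pascalʳ b (suc N) zero = begin
    1# + b ^ 1 * qbin R b (suc N) 1                          ≈⟨ +-congˡ (*-congˡ (qbin-pascalʳ b N 0)) ⟩
    1# + b ^ 1 * (b ^ N * qbin R b N 0 + qbin R b N 1)       ≈⟨ +-congˡ (distribˡ _ _ _) ⟩
    1# + (b ^ 1 * (b ^ N * qbin R b N 0) + b ^ 1 * qbin R b N 1) ≈⟨ +-congˡ (+-congʳ b^[1+N]) ⟩
    1# + (b ^ suc N * 1# + b ^ 1 * qbin R b N 1)             ≈⟨ x∙yz≈y∙xz _ _ _ ⟩
    b ^ suc N * 1# + (1# + b ^ 1 * qbin R b N 1)             ≡⟨ ≡.cong (λ x → b ^ suc N * 1# + (x + b ^ 1 * qbin R b N 1)) (qbin-zero b N) ⟨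
    b ^ suc N * 1# + (qbin R b N 0 + b ^ 1 * qbin R b N 1)   ∎
    where
    b^[1+N] : b ^ 1 * (b ^ N * qbin R b N 0) ≈ b ^ suc N * 1#
    b^[1+N] = begin
      (b * 1#) * (b ^ N * qbin R b N 0)  ≈⟨ *-congʳ (*-identityʳ b) ⟩
      b * (b ^ N * qbin R b N 0)         ≈⟨ *-assoc _ _ _ ⟨
      b ^ suc N * qbin R b N 0           ≡⟨ ≡.cong (b ^ suc N *_) (qbin-zero b N) ⟩
      b ^ suc N * 1#                     ∎
  qbin-pascalʳ b (suc N) (suc i) = begin
    qbin R b (suc N) (suc i) + b ^ suc (suc i) * qbin R b (suc N) (suc (suc i))
      ≈⟨ +-cong (qbin-pascalʳ b N i) (*-congˡ (qbin-pascalʳ b N (suc i))) ⟩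
    (b ^ (N ∸ i) * X + Y) + b ^ suc (suc i) * (b ^ (N ∸ suc i) * Y + W)
      ≈⟨ +-congˡ (distribˡ _ _ _) ⟩
    (b ^ (N ∸ i) * X + Y) + (b ^ suc (suc i) * (b ^ (N ∸ suc i) * Y) + b ^ suc (suc i) * W)
      ≈⟨ +-congˡ (+-congʳ (^-exchange-qbin b N i)) ⟩
    (b ^ (N ∸ i) * X + Y) + (b ^ (N ∸ i) * (b ^ suc i * Y) + b ^ suc (suc i) * W)
      ≈⟨ interchange _ _ _ _ ⟩
    (b ^ (N ∸ i) * X + b ^ (N ∸ i) * (b ^ suc i * Y)) + (Y + b ^ suc (suc i) * W)
      ≈⟨ +-congʳ (distribˡ _ _ _) ⟨
    b ^ (N ∸ i) * (X + b ^ suc i * Y) + (Y + b ^ suc (suc i) * W) ∎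
    where
    X = qbin R b N i
    Y = qbin R b N (suc i)
    W = qbin R b N (suc (suc i))

  qbin-sym : ∀ b N j → j ℕ.≤ N → qbin R b N (N ∸ j) ≈ qbin R b N j
  qbin-sym b zero zero _ = refl
  qbin-sym b (suc N) zero _ = qbin-diag b (suc N)
  qbin-sym b (suc N) (suc j) (s≤s j≤N) with ℕₚ.m≤n⇒m<n∨m≡n j≤N
  ... | inj₂ ≡.refl rewrite ℕₚ.n∸n≡0 j = sym (qbin-diag b (suc j))
  ... | inj₁ j<N rewrite ℕₚ.+-∸-assoc 1 j<N = begin
    qbin R b (suc N) (suc (N ∸ suc j))
      ≈⟨ qbin-pascalʳ b N (N ∸ suc j) ⟩
    b ^ (N ∸ (N ∸ suc j)) * qbin R b N (N ∸ suc j) + qbin R b N (suc (N ∸ suc j))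
      ≈⟨ +-cong (*-cong (reflexive (≡.cong (b ^_) (ℕₚ.m∸[m∸n]≡n j<N))) (qbin-sym b N (suc j) j<N))
                (trans (reflexive (≡.cong (qbin R b N) (≡.sym (ℕₚ.+-∸-assoc 1 j<N)))) (qbin-sym b N j j≤N)) ⟩
    b ^ suc j * qbin R b N (suc j) + qbin R b N j
      ≈⟨ +-comm _ _ ⟩
    qbin R b N j + b ^ suc j * qbin R b N (suc j) ∎

  ∑-qbin-pascal : ∀ b N (F A B : ℕ → Carrier) → F 0 ≈ B 0 →
             (∀ i → F (suc i) * qbin R b (suc N) (suc i) ≈ A i * qbin R b N i + B (suc i) * qbin R b N (suc i)) →
             ∑< (suc (suc N)) (λ i → F i * qbin R b (suc N) i) ≈ ∑< (suc N) (λ j → (A j + B j) * qbin R b N j)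
  ∑-qbin-pascal b N F A B F₀≈B₀ split = begin
    F 0 * 1# + ∑< (suc N) (λ i → F (suc i) * qbin R b (suc N) (suc i))
      ≈⟨ +-cong (*-cong F₀≈B₀ (reflexive (≡.sym (qbin-zero b N)))) (∑<-cong (suc N) (λ i _ → split i)) ⟩
    B 0 * qbin R b N 0 + ∑< (suc N) (λ i → Aᵢ i + Bᵢ (suc i))
      ≈⟨ +-congˡ (∑<-distrib-+ (suc N) Aᵢ (λ i → Bᵢ (suc i))) ⟩
    Bᵢ 0 + (∑< (suc N) Aᵢ + ∑< (suc N) (λ i → Bᵢ (suc i)))
      ≈⟨ x∙yz≈y∙xz _ _ _ ⟩
    ∑< (suc N) Aᵢ + ∑< (suc (suc N)) Bᵢ
      ≈⟨ +-congˡ (∑<-init-last (suc N) Bᵢ) ⟩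
    ∑< (suc N) Aᵢ + (∑< (suc N) Bᵢ + B (suc N) * qbin R b N (suc N))
      ≈⟨ +-congˡ (+-congˡ (trans (*-congˡ (qbin-above b N (suc N) ℕₚ.≤-refl)) (zeroʳ _))) ⟩
    ∑< (suc N) Aᵢ + (∑< (suc N) Bᵢ + 0#)
      ≈⟨ +-congˡ (+-identityʳ _) ⟩
    ∑< (suc N) Aᵢ + ∑< (suc N) Bᵢ
      ≈⟨ ∑<-distrib-+ (suc N) Aᵢ Bᵢ ⟨
    ∑< (suc N) (λ j → A j * qbin R b N j + B j * qbin R b N j)
      ≈⟨ ∑<-cong (suc N) (λ j _ → sym (distribʳ (qbin R b N j) (A j) (B j))) ⟩
    ∑< (suc N) (λ j → (A j + B j) * qbin R b N j) ∎
    where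
    Aᵢ Bᵢ : ℕ → Carrier
    Aᵢ i = A i * qbin R b N i
    Bᵢ i = B i * qbin R b N i

  ∑-qbin-reflect : ∀ b n (f g : ℕ → Carrier) → (∀ j → j ℕ.≤ n → f (n ∸ j) ≈ g j) →
                   ∑< (suc n) (λ j → f j * qbin R b n j) ≈ ∑< (suc n) (λ j → g j * qbin R b n j)
  ∑-qbin-reflect b n f g f∘reflect≈g = begin
    ∑< (suc n) (λ j → f j * qbin R b n j)                ≈⟨ ∑<-reverse (suc n) (λ j → f j * qbin R b n j) ⟩
    ∑< (suc n) (λ j → f (n ∸ j) * qbin R b n (n ∸ j))    ≈⟨ ∑<-cong (suc n) reflect ⟩
    ∑< (suc n) (λ j → g j * qbin R b n j)                ∎
    where
    reflect : ∀ j → j ℕ.< suc n → f (n ∸ j) * qbin R b n (n ∸ j) ≈ g j * qbin R b n j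
    reflect j (s≤s j≤n) = *-cong (f∘reflect≈g j j≤n) (qbin-sym b n j j≤n)

  -- Rothe's q-binomial theorem

  sgn : ℕ → Carrier
  sgn zero = 1#
  sgn (suc n) = - sgn n

  poch-suc : ∀ z p N → poch R z p (suc N) ≈ (1# - z) * poch R (z * p) p N
  poch-suc z p zero = begin
    1# * (1# - z * 1#)  ≈⟨ *-identityˡ _ ⟩
    1# - z * 1#         ≈⟨ +-congˡ (-‿cong (*-identityʳ z)) ⟩
    1# - z              ≈⟨ *-identityʳ _ ⟨
    (1# - z) * 1#       ∎
  poch-suc z p (suc N) = begin
    poch R z p (suc N) * (1# - z * (p * p ^ N))                ≈⟨ *-cong (poch-suc z p N) (+-congˡ (-‿cong (sym (*-assoc _ _ _)))) ⟩
    (1# - z) * poch R (z * p) p N * (1# - z * p * p ^ N)       ≈⟨ *-assoc _ _ _ ⟩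
    (1# - z) * (poch R (z * p) p N * (1# - z * p * p ^ N))     ∎

  module _ (p : Carrier) where

    rotheTerm : Carrier → ℕ → Carrier
    rotheTerm z i = sgn i * p ^ (i C 2) * z ^ i

    rotheTerm-suc : ∀ z j → rotheTerm z (suc j) + p ^ j * rotheTerm z j ≈ (1# - z) * rotheTerm (z * p) j
    rotheTerm-suc z j = begin
      - s * p ^ (suc j C 2) * (z * Z) + P * (s * Q * Z)
        ≈⟨ +-cong (*-congʳ (*-congˡ (trans (reflexive (≡.cong (p ^_) (C2-suc j))) (^-homo-* p (j C 2) j)))) (*.x∙yz≈yx∙z _ _ _) ⟩
      - s * (Q * P) * (z * Z) + s * Q * P * Z
        ≈⟨ +-cong (trans (*-congʳ (sym (-‿distribˡ-* _ _))) (sym (-‿distribˡ-* _ _))) (*-assoc _ _ _) ⟩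
      - (s * (Q * P) * (z * Z)) + s * Q * (P * Z)
        ≈⟨ +-cong (-‿cong first) (*-congˡ (*-comm P Z)) ⟩
      - (z * w) + w
        ≈⟨ +-comm _ _ ⟩
      w - z * w
        ≈⟨ +-congʳ (*-identityˡ w) ⟨
      1# * w - z * w
        ≈⟨ [y-z]x≈yx-zx w 1# z ⟨
      (1# - z) * (s * Q * (Z * P))
        ≈⟨ *-congˡ (*-congˡ (^-distrib-* z p j)) ⟨
      (1# - z) * rotheTerm (z * p) j ∎
      where
      s = sgn j
      Q = p ^ (j C 2)
      P = p ^ j
      Z = z ^ j
      w = s * Q * (Z * P)
      first : s * (Q * P) * (z * Z) ≈ z * w
      first = begin
        s * (Q * P) * (z * Z)  ≈⟨ *-congʳ (*-assoc s Q P) ⟨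
        s * Q * P * (z * Z)    ≈⟨ *.x∙yz≈y∙xz _ _ _ ⟩
        z * (s * Q * P * Z)    ≈⟨ *-congˡ (trans (*-assoc _ _ _) (*-congˡ (*-comm P Z))) ⟩
        z * w                  ∎

    q-binomial : ∀ N z → ∑< (suc N) (λ i → rotheTerm z i * qbin R p N i) ≈ poch R z p N
    q-binomial zero z = begin
      1# * 1# * 1# * 1# + 0#  ≈⟨ +-identityʳ _ ⟩
      1# * 1# * 1# * 1#       ≈⟨ trans (*-identityʳ _) (trans (*-identityʳ _) (*-identityʳ _)) ⟩
      1#                      ∎
    q-binomial (suc N) z = begin
      ∑< (suc (suc N)) (λ i → rotheTerm z i * qbin R p (suc N) i)
        ≈⟨ ∑-qbin-pascal p N (rotheTerm z) (λ j → rotheTerm z (suc j)) (λ j → p ^ j * rotheTerm z j) (sym (*-identityˡ _)) split ⟩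
      ∑< (suc N) (λ j → (rotheTerm z (suc j) + p ^ j * rotheTerm z j) * qbin R p N j)
        ≈⟨ ∑<-cong (suc N) (λ j _ → trans (*-congʳ (rotheTerm-suc z j)) (*-assoc (1# - z) (rotheTerm (z * p) j) (qbin R p N j))) ⟩
      ∑< (suc N) (λ j → (1# - z) * (rotheTerm (z * p) j * qbin R p N j))
        ≈⟨ *-distribˡ-∑< (suc N) (1# - z) (λ j → rotheTerm (z * p) j * qbin R p N j) ⟨
      (1# - z) * ∑< (suc N) (λ j → rotheTerm (z * p) j * qbin R p N j)
        ≈⟨ *-congˡ (q-binomial N (z * p)) ⟩
      (1# - z) * poch R (z * p) p N
        ≈⟨ poch-suc z p N ⟨
      poch R z p (suc N) ∎
      where
      split : ∀ i → rotheTerm z (suc i) * qbin R p (suc N) (suc i)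
                    ≈ rotheTerm z (suc i) * qbin R p N i + p ^ suc i * rotheTerm z (suc i) * qbin R p N (suc i)
      split i = trans (distribˡ _ _ _) (+-congˡ (trans (sym (*-assoc _ _ _)) (*-congʳ (*-comm _ _))))

  -- The inner sum

  rePart ωPart : Mod3 → Carrier → Carrier
  rePart 0₃ e = e
  rePart 1₃ e = 0#
  rePart 2₃ e = - e
  ωPart 0₃ e = 0#
  ωPart 1₃ e = e
  ωPart 2₃ e = - e

  on₁ on₂ : Mod3 → Carrier → Carrier
  on₁ 1₃ e = e
  on₁ _  e = 0#
  on₂ 2₃ e = e
  on₂ _  e = 0#

  ωPart+on₂≈on₁ : ∀ r e → ωPart r e + on₂ r e ≈ on₁ r e
  ωPart+on₂≈on₁ 0₃ e = +-identityʳ 0#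
  ωPart+on₂≈on₁ 1₃ e = +-identityʳ e
  ωPart+on₂≈on₁ 2₃ e = -‿inverseˡ e

  module _ (ω : Carrier) (ω²+ω+1≈0 : ω * ω + ω + 1# ≈ 0#) where

    ω²+ω≈-1 : ω * ω + ω ≈ - 1#
    ω²+ω≈-1 = inverseˡ-unique _ _ ω²+ω+1≈0

    ω²≈-[ω+1] : ω * ω ≈ - (ω + 1#)
    ω²≈-[ω+1] = inverseˡ-unique _ _ (trans (sym (+-assoc _ _ _)) ω²+ω+1≈0)

    ω³≈1 : ω * (ω * ω) ≈ 1#
    ω³≈1 = begin
      ω * (ω * ω)       ≈⟨ *-congˡ ω²≈-[ω+1] ⟩
      ω * - (ω + 1#)    ≈⟨ -‿distribʳ-* ω (ω + 1#) ⟨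
      - (ω * (ω + 1#))  ≈⟨ -‿cong (trans (distribˡ ω ω 1#) (+-congˡ (*-identityʳ ω))) ⟩
      - (ω * ω + ω)     ≈⟨ -‿cong ω²+ω≈-1 ⟩
      - - 1#            ≈⟨ ⁻¹-involutive 1# ⟩
      1#                ∎

    ω^-residue : ∀ k → ω ^ k ≈ ω ^ toℕ₃ (residue k)
    ω^-residue zero = refl
    ω^-residue (suc k) = trans (*-congˡ (ω^-residue k)) (ω*ω^r (residue k))
      where
      ω*ω^r : ∀ r → ω * ω ^ toℕ₃ r ≈ ω ^ toℕ₃ (suc₃ r)
      ω*ω^r 0₃ = refl
      ω*ω^r 1₃ = refl
      ω*ω^r 2₃ = trans (*-congˡ (*-congˡ (*-identityʳ ω))) ω³≈1

    ω-split : ∀ r e → e * ω ^ toℕ₃ r ≈ rePart r e + ω * ωPart r e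
    ω-split 0₃ e = begin
      e * 1#       ≈⟨ *-identityʳ e ⟩
      e            ≈⟨ +-identityʳ e ⟨
      e + 0#       ≈⟨ +-congˡ (zeroʳ ω) ⟨
      e + ω * 0#   ∎
    ω-split 1₃ e = begin
      e * (ω * 1#)  ≈⟨ *-congˡ (*-identityʳ ω) ⟩
      e * ω         ≈⟨ *-comm e ω ⟩
      ω * e         ≈⟨ +-identityˡ _ ⟨
      0# + ω * e    ∎
    ω-split 2₃ e = begin
      e * (ω * (ω * 1#))   ≈⟨ *-congˡ (*-congˡ (*-identityʳ ω)) ⟩
      e * (ω * ω)          ≈⟨ *-congˡ ω²≈-[ω+1] ⟩
      e * - (ω + 1#)       ≈⟨ -‿distribʳ-* e (ω + 1#) ⟨
      - (e * (ω + 1#))     ≈⟨ -‿cong (trans (distribˡ e ω 1#) (+-cong (*-comm e ω) (*-identityʳ e))) ⟩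
      - (ω * e + e)        ≈⟨ -‿cong (+-comm _ _) ⟩
      - (e + ω * e)        ≈⟨ ⁻¹-∙-comm e (ω * e) ⟨
      - e + - (ω * e)      ≈⟨ +-congˡ (-‿distribʳ-* ω e) ⟩
      - e + ω * - e        ∎

  module _ (q q⁻¹ : Carrier) (q*q⁻¹≈1 : q * q⁻¹ ≈ 1#) where

    weight : ℕ → ℕ → Carrier
    weight n k = zpow R q q⁻¹ (qExp k n)

    weight-shift : ∀ a k n b k′ n′ → a ℤ.+ qExp k n ≡ b ℤ.+ qExp k′ n′ →
                   zpow R q q⁻¹ a * weight n k ≈ zpow R q q⁻¹ b * weight n′ k′
    weight-shift a k n b k′ n′ eq = begin
      zpow R q q⁻¹ a * weight n k      ≈⟨ zpow-homo q q⁻¹ q*q⁻¹≈1 a (qExp k n) ⟨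
      zpow R q q⁻¹ (a ℤ.+ qExp k n)    ≡⟨ ≡.cong (zpow R q q⁻¹) eq ⟩
      zpow R q q⁻¹ (b ℤ.+ qExp k′ n′)  ≈⟨ zpow-homo q q⁻¹ q*q⁻¹≈1 b (qExp k′ n′) ⟩
      zpow R q q⁻¹ b * weight n′ k′    ∎

    D X : ℕ → Carrier
    D n = ∑< (suc n) (λ j → rePart (residue (n ℕ.+ j)) (weight n (n ℕ.+ j)) * qbin R q n j)
    X n = ∑< (suc n) (λ j → ωPart (residue (n ℕ.+ j)) (weight n (n ℕ.+ j)) * qbin R q n j)

    on₁-reflect : ∀ n j → j ℕ.≤ n → on₁ (residue (n ℕ.+ (n ∸ j))) (weight n (n ℕ.+ (n ∸ j)))
                                  ≈ on₂ (residue (n ℕ.+ j)) (weight n (n ℕ.+ j))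
    on₁-reflect n j j≤n with ℕₚ.m≤n⇒∃[o]m+o≡n j≤n
    ... | t , ≡.refl rewrite ℕₚ.m+n∸m≡n j t | residue-reflect j t with residue (j ℕ.+ t ℕ.+ t) in r≡
    ... | 0₃ = refl
    ... | 1₃ = reflexive (≡.cong (zpow R q q⁻¹) (qExp-reflect j t r≡))
    ... | 2₃ = refl

    X≈0 : ∀ n → X n ≈ 0#
    X≈0 n = identityˡ-unique (X n) (U on₂) (begin
      X n + U on₂
        ≈⟨ ∑<-distrib-+ (suc n) (λ j → ωPart (r j) (w j) * qbin R q n j) (λ j → on₂ (r j) (w j) * qbin R q n j) ⟨
      ∑< (suc n) (λ j → ωPart (r j) (w j) * qbin R q n j + on₂ (r j) (w j) * qbin R q n j)
        ≈⟨ ∑<-cong (suc n) (λ j _ → trans (sym (distribʳ (qbin R q n j) _ _)) (*-congʳ (ωPart+on₂≈on₁ (r j) (w j)))) ⟩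
      U on₁
        ≈⟨ ∑-qbin-reflect q n (λ j → on₁ (r j) (w j)) (λ j → on₂ (r j) (w j)) (on₁-reflect n) ⟩
      U on₂ ∎)
      where
      r : ℕ → Mod3
      r j = residue (n ℕ.+ j)
      w : ℕ → Carrier
      w j = weight n (n ℕ.+ j)
      U : (Mod3 → Carrier → Carrier) → Carrier
      U on = ∑< (suc n) (λ j → on (r j) (w j) * qbin R q n j)

    -- The term rePart r e · [N+1; i+1] with column index k ≡ r is split over [N; i] and [N; i+1] by the
    -- rule [N+1; i+1] = [N; i] + q^(i+1) [N; i+1] when k ≡ 0 and by qbin-pascalʳ when k ≡ 2; with these
    -- choices the coefficient of each [N; j] is a multiple of the matching term of D N (D-suc-coefficient).
    lowerPart upperPart : Mod3 → ℕ → Carrier → Carrier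
    lowerPart 0₃ d e = e
    lowerPart 1₃ d e = 0#
    lowerPart 2₃ d e = - (q ^ d * e)
    upperPart 0₃ i e = q ^ i * e
    upperPart 1₃ i e = 0#
    upperPart 2₃ i e = - e

    rePart≈upperPart₀ : ∀ r e → rePart r e ≈ upperPart r 0 e
    rePart≈upperPart₀ 0₃ e = sym (*-identityˡ e)
    rePart≈upperPart₀ 1₃ e = refl
    rePart≈upperPart₀ 2₃ e = refl

    rePart-pascal : ∀ r e N i → rePart r e * qbin R q (suc N) (suc i)
                                ≈ lowerPart r (N ∸ i) e * qbin R q N i + upperPart r (suc i) e * qbin R q N (suc i)
    rePart-pascal 0₃ e N i = trans (distribˡ e _ _) (+-congˡ (*.x∙yz≈yx∙z e (q ^ suc i) _))
    rePart-pascal 1₃ e N i = trans (zeroˡ _) (sym (trans (+-cong (zeroˡ _) (zeroˡ _)) (+-identityʳ 0#)))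
    rePart-pascal 2₃ e N i = begin
      - e * qbin R q (suc N) (suc i)                       ≈⟨ *-congˡ (qbin-pascalʳ q N i) ⟩
      - e * (q ^ (N ∸ i) * qbin R q N i + qbin R q N (suc i)) ≈⟨ distribˡ (- e) _ _ ⟩
      - e * (q ^ (N ∸ i) * qbin R q N i) + - e * qbin R q N (suc i)
        ≈⟨ +-congʳ (trans (*.x∙yz≈yx∙z (- e) (q ^ (N ∸ i)) _) (*-congʳ (sym (-‿distribʳ-* (q ^ (N ∸ i)) e)))) ⟩
      - (q ^ (N ∸ i) * e) * qbin R q N i + - e * qbin R q N (suc i) ∎

    D-suc-coefficient : ∀ N j → j ℕ.≤ N →
      lowerPart (residue (suc N ℕ.+ suc j)) (N ∸ j) (weight (suc N) (suc N ℕ.+ suc j))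
        + upperPart (residue (suc N ℕ.+ j)) j (weight (suc N) (suc N ℕ.+ j))
      ≈ - (q⁻¹ ^ suc N) * rePart (residue (N ℕ.+ j)) (weight N (N ℕ.+ j))
    D-suc-coefficient N j j≤N with ℕₚ.m≤n⇒∃[o]m+o≡n j≤N
    ... | t , ≡.refl rewrite ℕₚ.+-suc (j ℕ.+ t) j | ℕₚ.m+n∸m≡n j t with residue (j ℕ.+ t ℕ.+ j) in r≡
    ... | 0₃ = begin
      - (q ^ t * weight (1 ℕ.+ n) (2 ℕ.+ k)) + 0#  ≈⟨ +-identityʳ _ ⟩
      - (q ^ t * weight (1 ℕ.+ n) (2 ℕ.+ k))       ≈⟨ -‿cong (weight-shift (+ t) (2 ℕ.+ k) (1 ℕ.+ n) -[1+ n ] k n (qExp-step₀ j t r≡)) ⟩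
      - (q⁻¹ ^ suc n * weight n k)                 ≈⟨ -‿distribˡ-* _ _ ⟩
      - (q⁻¹ ^ suc n) * weight n k                 ∎
      where n = j ℕ.+ t; k = n ℕ.+ j
    ... | 1₃ = begin
      weight (1 ℕ.+ n) (2 ℕ.+ k) - weight (1 ℕ.+ n) (1 ℕ.+ k)  ≡⟨ ≡.cong (λ e → zpow R q q⁻¹ e - weight (1 ℕ.+ n) (1 ℕ.+ k)) (qExp-carry k (1 ℕ.+ n) r≡) ⟩
      weight (1 ℕ.+ n) (1 ℕ.+ k) - weight (1 ℕ.+ n) (1 ℕ.+ k)  ≈⟨ -‿inverseʳ _ ⟩
      0#                                                        ≈⟨ zeroʳ _ ⟨
      - (q⁻¹ ^ suc n) * 0#                                      ∎
      where n = j ℕ.+ t; k = n ℕ.+ j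
    ... | 2₃ = begin
      0# + q ^ j * weight (1 ℕ.+ n) (1 ℕ.+ k)  ≈⟨ +-identityˡ _ ⟩
      q ^ j * weight (1 ℕ.+ n) (1 ℕ.+ k)       ≈⟨ weight-shift (+ j) (1 ℕ.+ k) (1 ℕ.+ n) -[1+ n ] k n (qExp-step₂ j t r≡) ⟩
      q⁻¹ ^ suc n * weight n k                 ≈⟨ *-congˡ (⁻¹-involutive _) ⟨
      q⁻¹ ^ suc n * - - weight n k             ≈⟨ -x*y≈x*-y _ _ ⟨
      - (q⁻¹ ^ suc n) * - weight n k           ∎
      where n = j ℕ.+ t; k = n ℕ.+ j

    D-suc : ∀ N → D (suc N) ≈ - (q⁻¹ ^ suc N) * D N
    D-suc N = begin
      D (suc N)
        ≈⟨ ∑-qbin-pascal q N F A B (rePart≈upperPart₀ (residue (suc N ℕ.+ 0)) (w (suc N ℕ.+ 0)))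
                                 (λ i → rePart-pascal (residue (suc N ℕ.+ suc i)) (w (suc N ℕ.+ suc i)) N i) ⟩
      ∑< (suc N) (λ j → (A j + B j) * qbin R q N j)
        ≈⟨ ∑<-cong (suc N) (λ j j<1+N → trans (*-congʳ (D-suc-coefficient N j (ℕ.s≤s⁻¹ j<1+N))) (*-assoc _ _ (qbin R q N j))) ⟩
      ∑< (suc N) (λ j → a * d j)
        ≈⟨ *-distribˡ-∑< (suc N) a d ⟨
      a * D N ∎
      where
      a = - (q⁻¹ ^ suc N)
      d : ℕ → Carrier
      d j = rePart (residue (N ℕ.+ j)) (weight N (N ℕ.+ j)) * qbin R q N j
      w : ℕ → Carrier
      w k = weight (suc N) k
      F A B : ℕ → Carrier
      F i = rePart (residue (suc N ℕ.+ i)) (w (suc N ℕ.+ i))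
      A i = lowerPart (residue (suc N ℕ.+ suc i)) (N ∸ i) (w (suc N ℕ.+ suc i))
      B j = upperPart (residue (suc N ℕ.+ j)) j (w (suc N ℕ.+ j))

    D-closed : ∀ n → q ^ (suc n C 2) * D n ≈ sgn n
    D-closed zero = trans (*-identityˡ _) (trans (+-identityʳ _) (*-identityˡ 1#))
    D-closed (suc n) = begin
      q ^ (suc (suc n) C 2) * D (suc n)
        ≈⟨ *-cong (trans (reflexive (≡.cong (q ^_) (C2-suc (suc n)))) (^-homo-* q (suc n C 2) (suc n))) (D-suc n) ⟩
      (q ^ (suc n C 2) * q ^ suc n) * (- (q⁻¹ ^ suc n) * D n)
        ≈⟨ *-congʳ (*-comm _ _) ⟩
      (q ^ suc n * q ^ (suc n C 2)) * (- (q⁻¹ ^ suc n) * D n)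
        ≈⟨ *.interchange _ _ _ _ ⟩
      (q ^ suc n * - (q⁻¹ ^ suc n)) * (q ^ (suc n C 2) * D n)
        ≈⟨ *-cong (sym (-‿distribʳ-* _ _)) (D-closed n) ⟩
      - (q ^ suc n * q⁻¹ ^ suc n) * sgn n
        ≈⟨ *-congʳ (-‿cong (^-inverse q q⁻¹ q*q⁻¹≈1 (suc n))) ⟩
      - 1# * sgn n
        ≈⟨ -‿distribˡ-* 1# (sgn n) ⟨
      - (1# * sgn n)
        ≈⟨ -‿cong (*-identityˡ _) ⟩
      - sgn n ∎

    module _ (ω : Carrier) (ω²+ω+1≈0 : ω * ω + ω + 1# ≈ 0#) where

      inner : ℕ → Carrier
      inner n = sumRange R n (2 ℕ.* n) (λ k → weight n k * qbin R q n (k ∸ n) * ω ^ k)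

      inner≈D+ωX : ∀ n → inner n ≈ D n + ω * X n
      inner≈D+ωX n = begin
        inner n
          ≡⟨ ≡.cong (λ L → sumFrom R n L f) length ⟩
        sumFrom R n (suc n) f
          ≈⟨ sumFrom≈∑< n (suc n) f ⟩
        ∑< (suc n) (λ j → f (n ℕ.+ j))
          ≈⟨ ∑<-cong (suc n) (λ j _ → split j) ⟩
        ∑< (suc n) (λ j → rePart (r j) (w j) * qbin R q n j + ω * (ωPart (r j) (w j) * qbin R q n j))
          ≈⟨ ∑<-distrib-+ (suc n) (λ j → rePart (r j) (w j) * qbin R q n j) (λ j → ω * (ωPart (r j) (w j) * qbin R q n j)) ⟩
        D n + ∑< (suc n) (λ j → ω * (ωPart (r j) (w j) * qbin R q n j))
          ≈⟨ +-congˡ (*-distribˡ-∑< (suc n) ω (λ j → ωPart (r j) (w j) * qbin R q n j)) ⟨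
        D n + ω * X n ∎
        where
        f : ℕ → Carrier
        f k = weight n k * qbin R q n (k ∸ n) * ω ^ k
        r : ℕ → Mod3
        r j = residue (n ℕ.+ j)
        w : ℕ → Carrier
        w j = weight n (n ℕ.+ j)
        length : suc (2 ℕ.* n) ∸ n ≡ suc n
        length = ≡.trans (≡.cong (λ m → suc (n ℕ.+ m) ∸ n) (ℕₚ.+-identityʳ n)) (ℕₚ.m+n∸n≡m (suc n) n)
        split : ∀ j → f (n ℕ.+ j) ≈ rePart (r j) (w j) * qbin R q n j + ω * (ωPart (r j) (w j) * qbin R q n j)
        split j = begin
          w j * qbin R q n (n ℕ.+ j ∸ n) * ω ^ (n ℕ.+ j)   ≡⟨ ≡.cong (λ i → w j * qbin R q n i * ω ^ (n ℕ.+ j)) (ℕₚ.m+n∸m≡n n j) ⟩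
          w j * qbin R q n j * ω ^ (n ℕ.+ j)               ≈⟨ *.xy∙z≈xz∙y _ _ _ ⟩
          w j * ω ^ (n ℕ.+ j) * qbin R q n j               ≈⟨ *-congʳ (*-congˡ (ω^-residue ω ω²+ω+1≈0 (n ℕ.+ j))) ⟩
          w j * ω ^ toℕ₃ (r j) * qbin R q n j              ≈⟨ *-congʳ (ω-split ω ω²+ω+1≈0 (r j) (w j)) ⟩
          (rePart (r j) (w j) + ω * ωPart (r j) (w j)) * qbin R q n j
            ≈⟨ distribʳ _ _ _ ⟩
          rePart (r j) (w j) * qbin R q n j + ω * ωPart (r j) (w j) * qbin R q n j
            ≈⟨ +-congˡ (*-assoc _ _ _) ⟩
          rePart (r j) (w j) * qbin R q n j + ω * (ωPart (r j) (w j) * qbin R q n j) ∎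

      inner-normalised : ∀ n → q ^ (suc n C 2) * inner n ≈ sgn n
      inner-normalised n = begin
        q ^ (suc n C 2) * inner n          ≈⟨ *-congˡ (inner≈D+ωX n) ⟩
        q ^ (suc n C 2) * (D n + ω * X n)  ≈⟨ *-congˡ (+-congˡ (trans (*-congˡ (X≈0 n)) (zeroʳ ω))) ⟩
        q ^ (suc n C 2) * (D n + 0#)       ≈⟨ *-congˡ (+-identityʳ (D n)) ⟩
        q ^ (suc n C 2) * D n              ≈⟨ D-closed n ⟩
        sgn n                              ∎

theorem3 : {c ℓ : Level} (R : CommutativeRing c ℓ) →
    let open CommutativeRing R in
    (p q qi z ω : Carrier) →
    q * qi ≈ 1# →
    ω * ω + ω + 1# ≈ 0# →
    (m : ℕ) →
    theorem3LHS R p q qi z ω m ≈ poch R z p (3 Data.Nat.* m)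
theorem3 R p q qi z ω q*qi≈1 ω²+ω+1≈0 m = begin
  theorem3LHS R p q qi z ω m
    ≈⟨ sumFrom≈∑< R 0 (suc N) summand ⟩
  ∑< R (suc N) summand
    ≈⟨ ∑<-cong R (suc N) (λ n _ → summand≈rotheTerm n) ⟩
  ∑< R (suc N) (λ n → rotheTerm R p z n * qbin R p N n)
    ≈⟨ q-binomial R p N z ⟩
  poch R z p N ∎
  where
  open CommutativeRing R
  open import Relation.Binary.Reasoning.Setoid setoid
  open import Algebra.Properties.CommutativeSemigroup *-commutativeSemigroup using (xy∙z≈xz∙y)
  N = 3 ℕ.* m
  I = inner R q qi q*qi≈1 ω ω²+ω+1≈0
  summand : ℕ → Carrier
  summand n = pow R q (suc n C 2) * pow R p (n C 2) * pow R z n * qbin R p N n * I n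
  summand≈rotheTerm : ∀ n → summand n ≈ rotheTerm R p z n * qbin R p N n
  summand≈rotheTerm n = begin
    pow R q (suc n C 2) * pow R p (n C 2) * pow R z n * qbin R p N n * I n
      ≈⟨ trans (xy∙z≈xz∙y _ _ _) (*-congʳ (trans (xy∙z≈xz∙y _ _ _) (*-congʳ (xy∙z≈xz∙y _ _ _)))) ⟩
    pow R q (suc n C 2) * I n * pow R p (n C 2) * pow R z n * qbin R p N n
      ≈⟨ *-congʳ (*-congʳ (*-congʳ (inner-normalised R q qi q*qi≈1 ω ω²+ω+1≈0 n))) ⟩
    sgn R n * pow R p (n C 2) * pow R z n * qbin R p N n ∎
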